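{- A Dyck path $\mathfrak p\in D_n^B$ with height sequence $(h_1,\dots,h_k)$ is regular in the Heyting algebra $\mathcal{D}_n^B$ if and only if one of the following holds: (1) $h_k=n$, and for every $i\in[k-1]$ either $h_i=i$, or $h_i=c>i$ and $h_i=h_{i+1}=\dots=h_c=c$; or (2) $h_k=2n-k+1$, $h_{k-1}=k-1$ (with the convention $h_0=0$), and for every $i\in[k-2]$ either $h_i=i$, or $h_i=c>i$ and $h_i=h_{i+1}=\dots=h_c=c$.
   Context: $D_n^B$ is the set of words (Dyck paths of type $B$) of length $2n$ over $\{u,r\}$ in which every prefix contains at least as many $u$'s as $r$'s. Height sequence of $w\in D_n^B$: let $\rho$ be the number of $r$'s. If $w$ ends with $r$, $k=\rho$ and $h_i$ is the number of $u$'s preceding the $i$-th $r$; if $w$ ends with $u$, $k=\rho+1$, $h_i$ ($i\le\rho$) as before and $h_k$ is the total number of $u$'s. Dominance order: $(h_1,\dots,h_k)\le_D(h'_1,\dots,h'_{k'})$ iff $k\ge k'$ and $h_i\le h'_i$ for $i\in[k']$; $\mathcal{D}_n^B=(D_n^B,\le_D)$ is a finite distributive lattice, hence a Heyting algebra, with least element of height sequence $(1,2,\dots,n)$. Pseudocomplement $x^{\mathsf c}$ is the greatest $z$ with $x\wedge z=\hat0$; $x$ is regular if $(x^{\mathsf c})^{\mathsf c}=x$. -}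

module Defs where

open import Data.Nat using (ℕ; zero; suc; _+_; _*_; _∸_; _≤_; _<_)
open import Data.List using (List; []; _∷_; _++_; [_]; length; take; last)
open import Data.Maybe using (Maybe; just; nothing)
open import Data.Product using (Σ; _×_; _,_)
open import Data.Sum using (_⊎_)
open import Relation.Binary.PropositionalEquality using (_≡_)

data Letter : Set where
  u r : Letter

countU : List Letter → ℕ
countU []      = 0
countU (u ∷ w) = suc (countU w)
countU (r ∷ w) = countU w

countR : List Letter → ℕ
countR []      = 0
countR (u ∷ w) = countR w
countR (r ∷ w) = suc (countR w)

IsDyckB : List Letter → Set
IsDyckB w = ∀ m → countR (take m w) ≤ countU (take m w)

record DB (n : ℕ) : Set where
  constructor mkDB
  field
    word  : List Letter
    len   : length word ≡ 2 * n
    dyck  : IsDyckB word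
open DB public

heightsR : ℕ → List Letter → List ℕ
heightsR c []      = []
heightsR c (u ∷ w) = heightsR (suc c) w
heightsR c (r ∷ w) = c ∷ heightsR c w

heightSeqW : List Letter → Maybe Letter → List ℕ
heightSeqW w (just u) = heightsR 0 w ++ [ countU w ]
heightSeqW w _        = heightsR 0 w

heightSeq : List Letter → List ℕ
heightSeq w = heightSeqW w (last w)

-- Dominance order on sequences: (h_1..h_k) ≤ (h'_1..h'_k') iff k ≥ k'
-- and h_i ≤ h'_i for i ∈ [k'].
data DomSeq : List ℕ → List ℕ → Set where
  dom-[] : ∀ {xs} → DomSeq xs []
  dom-∷  : ∀ {x y xs ys} → x ≤ y → DomSeq xs ys → DomSeq (x ∷ xs) (y ∷ ys)

_≤D_ : ∀ {n} → DB n → DB n → Set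
p ≤D q = DomSeq (heightSeq (word p)) (heightSeq (word q))

IsBottom : ∀ {n} → DB n → Set
IsBottom {n} p = ∀ (q : DB n) → p ≤D q

-- x ∧ z = 0̂  (in a lattice: every common lower bound is the bottom).
MeetIsBottom : ∀ {n} → DB n → DB n → Set
MeetIsBottom {n} x z = ∀ (y : DB n) → y ≤D x → y ≤D z → IsBottom y

IsPseudocomplement : ∀ {n} → DB n → DB n → Set
IsPseudocomplement {n} x z =
  MeetIsBottom x z × (∀ (z' : DB n) → MeetIsBottom x z' → z' ≤D z)

-- x is regular: (x^c)^c = x.
IsRegular : ∀ {n} → DB n → Set
IsRegular {n} x = Σ (DB n) λ xc → IsPseudocomplement x xc × IsPseudocomplement xc x

-- 1-based access h_i with the convention h_0 = 0 (default 0 out of range).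
hAt : List ℕ → ℕ → ℕ
hAt hs       zero          = 0
hAt []       (suc i)       = 0
hAt (h ∷ hs) (suc zero)    = h
hAt (h ∷ hs) (suc (suc i)) = hAt hs (suc i)

-- For every i ∈ [m]: h_i = i, or h_i = c > i and h_i = h_{i+1} = ... = h_c = c
-- (in particular c ≤ k, so that h_c is defined).
BlockCond : List ℕ → ℕ → Set
BlockCond hs m = ∀ i → 1 ≤ i → i ≤ m →
  (hAt hs i ≡ i) ⊎
  (i < hAt hs i × hAt hs i ≤ length hs ×
    (∀ j → i ≤ j → j ≤ hAt hs i → hAt hs j ≡ hAt hs i))

Cond1 : ℕ → List ℕ → Set
Cond1 n hs = hAt hs (length hs) ≡ n × BlockCond hs (length hs ∸ 1)

Cond2 : ℕ → List ℕ → Set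
Cond2 n hs = hAt hs (length hs) ≡ 2 * n ∸ length hs + 1
           × hAt hs (length hs ∸ 1) ≡ length hs ∸ 1
           × BlockCond hs (length hs ∸ 2)

-- Call i ∈ [n] a fixed point of a path if h_i = i. Two paths meet in 0̂ iff every i ∈ [n] is
-- fixed by one of them: otherwise the atom with heights (1, …, n) raised by one at i lies below
-- both. For S ⊆ [n] with maximum m, the greatest path fixing S has h_j = the least element of S
-- from j on, for j ≤ m, followed when m < n by the single height 2n − m; it fixes exactly S.
-- Hence the pseudocomplement of x is the greatest path fixing the points x does not fix, and x is
-- regular iff it is the greatest path fixing its own fixed points. Conditions (1) and (2)
-- describe exactly these canonical sequences, according as n is a fixed point or not.

module Submission where

open import Defs
open import Data.Bool using (Bool; true; false; if_then_else_; not)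
open import Data.Bool.Properties using (T-≡; ¬-not; not-¬)
open import Data.Empty using (⊥; ⊥-elim)
open import Data.List using (List; []; _∷_; _++_; [_]; _∷ʳ_; length; take; last; replicate; applyUpTo; initLast; _∷ʳ′_)
open import Data.List.Properties using (++-assoc; ++-identityʳ; length-applyUpTo; applyUpTo-∷ʳ)
open import Data.Maybe using (just)
open import Data.Nat
open import Data.Nat.Properties
open import Relation.Binary.Definitions using (tri<; tri≈; tri>)
open import Data.Product using (Σ; _×_; _,_; proj₁; proj₂)
open import Data.Sum using (_⊎_; inj₁; inj₂; [_,_]′; swap)
open import Data.Unit using (⊤; tt)
open import Function.Bundles using (_⇔_; mk⇔; Equivalence)
open import Relation.Binary.PropositionalEquality hiding ([_])
open import Relation.Nullary using (yes; no; ¬_)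

countU-++ : ∀ v w → countU (v ++ w) ≡ countU v + countU w
countU-++ []      w = refl
countU-++ (u ∷ v) w = cong suc (countU-++ v w)
countU-++ (r ∷ v) w = countU-++ v w

countR-++ : ∀ v w → countR (v ++ w) ≡ countR v + countR w
countR-++ []      w = refl
countR-++ (u ∷ v) w = countR-++ v w
countR-++ (r ∷ v) w = cong suc (countR-++ v w)

heightsR-++ : ∀ c v w → heightsR c (v ++ w) ≡ heightsR c v ++ heightsR (c + countU v) w
heightsR-++ c []      w = cong (λ d → heightsR d w) (sym (+-identityʳ c))
heightsR-++ c (u ∷ v) w =
  trans (heightsR-++ (suc c) v w) (cong (λ d → heightsR (suc c) v ++ heightsR d w) (sym (+-suc c (countU v))))
heightsR-++ c (r ∷ v) w = cong (c ∷_) (heightsR-++ c v w)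

length-heightsR : ∀ c w → length (heightsR c w) ≡ countR w
length-heightsR c []      = refl
length-heightsR c (u ∷ w) = length-heightsR (suc c) w
length-heightsR c (r ∷ w) = cong suc (length-heightsR c w)

length≡countU+countR : ∀ w → length w ≡ countU w + countR w
length≡countU+countR []      = refl
length≡countU+countR (u ∷ w) = cong suc (length≡countU+countR w)
length≡countU+countR (r ∷ w) = trans (cong suc (length≡countU+countR w)) (sym (+-suc (countU w) (countR w)))

last-∷ʳ : ∀ (w : List Letter) x → last (w ∷ʳ x) ≡ just x
last-∷ʳ []          x = refl
last-∷ʳ (a ∷ [])    x = refl
last-∷ʳ (a ∷ b ∷ w) x = last-∷ʳ (b ∷ w) x

heightSeq-∷ʳ : ∀ w x → heightSeq (w ∷ʳ x) ≡ heightsR 0 w ∷ʳ countU (w ∷ʳ x)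
heightSeq-∷ʳ w u rewrite last-∷ʳ w u | heightsR-++ 0 w [ u ] =
  cong (_∷ʳ countU (w ∷ʳ u)) (++-identityʳ (heightsR 0 w))
heightSeq-∷ʳ w r rewrite last-∷ʳ w r | heightsR-++ 0 w [ r ] | countU-++ w [ r ] =
  cong (λ h → heightsR 0 w ∷ʳ h) (sym (+-identityʳ (countU w)))

countU-replicate : ∀ a → countU (replicate a u) ≡ a
countU-replicate zero    = refl
countU-replicate (suc a) = cong suc (countU-replicate a)

countR-replicate : ∀ a → countR (replicate a u) ≡ 0
countR-replicate zero    = refl
countR-replicate (suc a) = countR-replicate a

heightsR-replicate : ∀ c a → heightsR c (replicate a u) ≡ []
heightsR-replicate c zero    = refl
heightsR-replicate c (suc a) = heightsR-replicate (suc c) a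

DyckFrom : ℕ → List Letter → Set
DyckFrom d       []      = ⊤
DyckFrom d       (u ∷ w) = DyckFrom (suc d) w
DyckFrom zero    (r ∷ w) = ⊥
DyckFrom (suc d) (r ∷ w) = DyckFrom d w

prefixes⇒DyckFrom : ∀ d w → (∀ m → countR (take m w) ≤ d + countU (take m w)) → DyckFrom d w
prefixes⇒DyckFrom d       []      h = tt
prefixes⇒DyckFrom d       (u ∷ w) h =
  prefixes⇒DyckFrom (suc d) w λ m → ≤-trans (h (suc m)) (≤-reflexive (+-suc d _))
prefixes⇒DyckFrom zero    (r ∷ w) h with h 1
... | ()
prefixes⇒DyckFrom (suc d) (r ∷ w) h = prefixes⇒DyckFrom d w λ m → ≤-pred (h (suc m))

DyckFrom⇒prefixes : ∀ d w → DyckFrom d w → ∀ m → countR (take m w) ≤ d + countU (take m w)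
DyckFrom⇒prefixes d       w       h zero    = z≤n
DyckFrom⇒prefixes d       []      h (suc m) = z≤n
DyckFrom⇒prefixes d       (u ∷ w) h (suc m) =
  ≤-trans (DyckFrom⇒prefixes (suc d) w h m) (≤-reflexive (sym (+-suc d _)))
DyckFrom⇒prefixes (suc d) (r ∷ w) h (suc m) = s≤s (DyckFrom⇒prefixes d w h m)

DyckFrom-replicate : ∀ a d w → DyckFrom (a + d) w → DyckFrom d (replicate a u ++ w)
DyckFrom-replicate zero    d w h = h
DyckFrom-replicate (suc a) d w h = DyckFrom-replicate a (suc d) w (subst (λ e → DyckFrom e w) (sym (+-suc a d)) h)

2*n≡n+n : ∀ n → 2 * n ≡ n + n
2*n≡n+n n = cong (n +_) (+-identityʳ n)

2*n∸n≡n : ∀ n → 2 * n ∸ n ≡ n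
2*n∸n≡n n = trans (cong (_∸ n) (2*n≡n+n n)) (m+n∸n≡m n n)

m∸[1+n]+1≡m∸n : ∀ {m n} → suc n ≤ m → m ∸ suc n + 1 ≡ m ∸ n
m∸[1+n]+1≡m∸n p = trans (+-comm _ 1) (sym (+-∸-assoc 1 p))

k≤2n∸k+1⇒k≤n : ∀ n k → 1 ≤ n → k ≤ 2 * n ∸ k + 1 → k ≤ n
k≤2n∸k+1⇒k≤n n k 1≤n k≤ with k ≤? 2 * n
... | no k≰2n rewrite m≤n⇒m∸n≡0 (<⇒≤ (≰⇒> k≰2n)) = ≤-trans k≤ 1≤n
... | yes k≤2n = ≮⇒≥ λ n<k → <-irrefl refl (begin-strict
      suc (n + n)          <⟨ s≤s (≤-reflexive (sym (+-suc n n))) ⟩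
      suc n + suc n        ≤⟨ +-mono-≤ n<k n<k ⟩
      k + k                ≤⟨ +-monoˡ-≤ k k≤ ⟩
      2 * n ∸ k + 1 + k    ≡⟨ cong (_+ k) (+-comm _ 1) ⟩
      suc (2 * n ∸ k + k)  ≡⟨ cong suc (m∸n+n≡m k≤2n) ⟩
      suc (2 * n)          ≡⟨ cong suc (2*n≡n+n n) ⟩
      suc (n + n)          ∎)
  where open ≤-Reasoning

2n∸k+1≢k : ∀ n k → 1 ≤ n → 2 * n ∸ k + 1 ≢ k
2n∸k+1≢k n k 1≤n eq with k ≤? 2 * n
... | no k≰2n rewrite m≤n⇒m∸n≡0 (<⇒≤ (≰⇒> k≰2n)) =
  k≰2n (≤-trans (≤-reflexive (sym eq)) (≤-trans 1≤n (m≤m+n n _)))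
... | yes k≤2n = even≢odd k n (begin
      2 * k                ≡⟨ 2*n≡n+n k ⟩
      k + k                ≡⟨ cong (_+ k) (sym eq) ⟩
      2 * n ∸ k + 1 + k    ≡⟨ cong (_+ k) (+-comm _ 1) ⟩
      suc (2 * n ∸ k + k)  ≡⟨ cong suc (m∸n+n≡m k≤2n) ⟩
      suc (2 * n)          ∎)
  where open ≡-Reasoning

k<n⇒2n∸k≢k : ∀ n k → k < n → 2 * n ∸ k ≢ k
k<n⇒2n∸k≢k n k k<n eq = <-irrefl (*-cancelˡ-≡ k n 2 (begin
      2 * k          ≡⟨ 2*n≡n+n k ⟩
      k + k          ≡⟨ cong (_+ k) (sym eq) ⟩
      2 * n ∸ k + k  ≡⟨ m∸n+n≡m (≤-trans (<⇒≤ k<n) (m≤m+n n _)) ⟩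
      2 * n          ∎)) k<n
  where open ≡-Reasoning

n≡2n∸k⇒k≡n : ∀ n k → k ≤ n → n ≡ 2 * n ∸ k → k ≡ n
n≡2n∸k⇒k≡n n k k≤n eq = +-cancelˡ-≡ n k n (begin
      n + k          ≡⟨ cong (_+ k) eq ⟩
      2 * n ∸ k + k  ≡⟨ m∸n+n≡m (≤-trans k≤n (m≤m+n n _)) ⟩
      2 * n          ≡⟨ 2*n≡n+n n ⟩
      n + n          ∎)
  where open ≡-Reasoning

k≤n⇒n≢2n∸k+1 : ∀ n k → k ≤ n → n ≢ 2 * n ∸ k + 1
k≤n⇒n≢2n∸k+1 n k k≤n eq = <-irrefl refl (begin-strict
      n + k                ≤⟨ +-monoʳ-≤ n k≤n ⟩
      n + n                ≡⟨ sym (2*n≡n+n n) ⟩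
      2 * n                ≡⟨ sym (m∸n+n≡m (≤-trans k≤n (m≤m+n n _))) ⟩
      2 * n ∸ k + k        <⟨ +-monoˡ-< k (m<m+n _ (s≤s z≤n)) ⟩
      2 * n ∸ k + 1 + k    ≡⟨ cong (_+ k) (sym eq) ⟩
      n + k                ∎)
  where open ≤-Reasoning

2n∸[1+m]+1≡2n∸m : ∀ n {m} → m < n → 2 * n ∸ suc m + 1 ≡ 2 * n ∸ m
2n∸[1+m]+1≡2n∸m n m<n = m∸[1+n]+1≡m∸n (≤-trans m<n (m≤m+n n _))

2n∸k+1≤2n∸m : ∀ n m k → m < k → k ≤ n → 2 * n ∸ k + 1 ≤ 2 * n ∸ m
2n∸k+1≤2n∸m n m (suc k) (s≤s m≤k) k<n =
  ≤-trans (≤-reflexive (2n∸[1+m]+1≡2n∸m n k<n)) (∸-monoʳ-≤ (2 * n) m≤k)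

m<n⇒1+m≤2n∸m : ∀ n m → m < n → suc m ≤ 2 * n ∸ m
m<n⇒1+m≤2n∸m n m m<n = m+n≤o⇒m≤o∸n (suc m) (≤-trans (+-mono-≤ m<n (<⇒≤ m<n)) (≤-reflexive (sym (2*n≡n+n n))))

m<n⇒m≤2n∸[1+m] : ∀ n m → m < n → m ≤ 2 * n ∸ suc m
m<n⇒m≤2n∸[1+m] n m m<n = m+n≤o⇒m≤o∸n m (≤-trans (≤-reflexive (+-suc m m))
  (≤-trans (+-mono-≤ m<n (<⇒≤ m<n)) (≤-reflexive (sym (2*n≡n+n n)))))

length-∷ʳ : ∀ {A : Set} (xs : List A) x → length (xs ∷ʳ x) ≡ suc (length xs)
length-∷ʳ []       x = refl
length-∷ʳ (_ ∷ xs) x = cong suc (length-∷ʳ xs x)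

hAt-∷ʳ-last : ∀ hs (e : ℕ) → hAt (hs ∷ʳ e) (suc (length hs)) ≡ e
hAt-∷ʳ-last []       e = refl
hAt-∷ʳ-last (h ∷ hs) e = hAt-∷ʳ-last hs e

hAt-beyond : ∀ hs i → length hs < i → hAt hs i ≡ 0
hAt-beyond []       zero          _         = refl
hAt-beyond []       (suc i)       _         = refl
hAt-beyond (h ∷ hs) (suc (suc i)) (s≤s lt) = hAt-beyond hs (suc i) lt

fixed⇒≤length : ∀ hs i → 1 ≤ i → hAt hs i ≡ i → i ≤ length hs
fixed⇒≤length hs (suc i) _ eq = ≮⇒≥ λ lt → 0≢1+n (trans (sym (hAt-beyond hs (suc i) lt)) eq)

hAt-applyUpTo : ∀ g k i → i < k → hAt (applyUpTo g k) (suc i) ≡ g i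
hAt-applyUpTo g (suc k) zero    _        = refl
hAt-applyUpTo g (suc k) (suc i) (s≤s lt) = hAt-applyUpTo (λ j → g (suc j)) k i lt

-- Rising j c hs: hs is weakly increasing from c, and its i-th entry is at least j + i.
Rising : ℕ → ℕ → List ℕ → Set
Rising j c []       = ⊤
Rising j c (h ∷ hs) = c ≤ h × suc j ≤ h × Rising (suc j) h hs

Rising-weaken : ∀ j {c c'} hs → c' ≤ c → Rising j c hs → Rising j c' hs
Rising-weaken j []       _    _               = tt
Rising-weaken j (h ∷ hs) c'≤c (c≤h , j<h , ρ) = ≤-trans c'≤c c≤h , j<h , ρ

Rising-≥start : ∀ j c hs → Rising j c hs → ∀ i → 1 ≤ i → i ≤ length hs → c ≤ hAt hs i
Rising-≥start j c (h ∷ hs) (c≤h , _ , ρ) (suc zero)    _ _ = c≤h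
Rising-≥start j c (h ∷ hs) (c≤h , _ , ρ) (suc (suc i)) _ (s≤s i≤) =
  ≤-trans c≤h (Rising-≥start (suc j) h hs ρ (suc i) (s≤s z≤n) i≤)

Rising-≥diag : ∀ j c hs → Rising j c hs → ∀ i → 1 ≤ i → i ≤ length hs → j + i ≤ hAt hs i
Rising-≥diag j c (h ∷ hs) (_ , j<h , ρ) (suc zero)    _ _ = ≤-trans (≤-reflexive (+-comm j 1)) j<h
Rising-≥diag j c (h ∷ hs) (_ , j<h , ρ) (suc (suc i)) _ (s≤s i≤) =
  ≤-trans (≤-reflexive (+-suc j (suc i))) (Rising-≥diag (suc j) h hs ρ (suc i) (s≤s z≤n) i≤)

Rising-mono : ∀ j c hs → Rising j c hs → ∀ i i' → 1 ≤ i → i ≤ i' → i' ≤ length hs → hAt hs i ≤ hAt hs i'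
Rising-mono j c (h ∷ hs) ρ (suc zero) (suc zero) _ _ _ = ≤-refl
Rising-mono j c (h ∷ hs) (_ , _ , ρ) (suc zero) (suc (suc i')) _ _ (s≤s i'≤) =
  Rising-≥start (suc j) h hs ρ (suc i') (s≤s z≤n) i'≤
Rising-mono j c (h ∷ hs) (_ , _ , ρ) (suc (suc i)) (suc (suc i')) _ (s≤s i≤i') (s≤s i'≤) =
  Rising-mono (suc j) h hs ρ (suc i) (suc i') (s≤s z≤n) i≤i' i'≤

Rising-applyUpTo : ∀ j c g k → (0 < k → c ≤ g 0) → (∀ i → i < k → suc (j + i) ≤ g i) →
  (∀ i → suc i < k → g i ≤ g (suc i)) → Rising j c (applyUpTo g k)
Rising-applyUpTo j c g zero    _     _    _    = tt
Rising-applyUpTo j c g (suc k) c≤g₀ diag mono =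
  c≤g₀ (s≤s z≤n) ,
  ≤-trans (≤-reflexive (cong suc (sym (+-identityʳ j)))) (diag 0 (s≤s z≤n)) ,
  Rising-applyUpTo (suc j) (g 0) (λ i → g (suc i)) k
    (λ 0<k → mono 0 (s≤s 0<k))
    (λ i i<k → ≤-trans (≤-reflexive (cong suc (sym (+-suc j i)))) (diag (suc i) (s≤s i<k)))
    (λ i i<k → mono (suc i) (s≤s i<k))

-- Reading w starts after j r's and j + d u's.
heightsR-rising : ∀ j d w x → DyckFrom d (w ∷ʳ x) →
  Rising j (j + d) (heightsR (j + d) w ∷ʳ (j + d + countU (w ∷ʳ x)))
heightsR-rising j d       []      u _ =
  m≤m+n (j + d) 1 , ≤-trans (s≤s (m≤m+n j d)) (≤-reflexive (+-comm 1 (j + d))) , tt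
heightsR-rising j (suc d) []      r _ =
  m≤m+n (j + suc d) 0 , ≤-trans (s≤s (m≤m+n j d)) (≤-reflexive (sym (trans (+-identityʳ _) (+-suc j d)))) , tt
heightsR-rising j d       (u ∷ w) x h with heightsR-rising j (suc d) w x h
... | ρ rewrite +-suc j d | +-suc (j + d) (countU (w ∷ʳ x)) = Rising-weaken j _ (n≤1+n _) ρ
heightsR-rising j (suc d) (r ∷ w) x h with heightsR-rising (suc j) d w x h
... | ρ rewrite +-suc j d = ≤-refl , s≤s (m≤m+n j d) , ρ

-- The two possible last heights of a path of length N with k heights: it ends with r, resp. with u.
LastHeight : ℕ → ℕ → ℕ → Set
LastHeight N k e = (e ≡ N ∸ k) ⊎ (e ≡ N ∸ k + 1)

LastHeight-≤ : ∀ {N k e} → LastHeight N k e → e ≤ N ∸ k + 1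
LastHeight-≤ (inj₁ e≡) = ≤-trans (≤-reflexive e≡) (m≤m+n _ 1)
LastHeight-≤ (inj₂ e≡) = ≤-reflexive e≡

countU-∷ʳ : ∀ w x → LastHeight (suc (countU w + countR w)) (suc (countR w)) (countU (w ∷ʳ x))
countU-∷ʳ w u rewrite countU-++ w [ u ] = inj₂ (cong (_+ 1) (sym (m+n∸n≡m _ (countR w))))
countU-∷ʳ w r rewrite countU-++ w [ r ] = inj₁ (trans (+-identityʳ _) (sym (m+n∸n≡m _ (countR w))))

record IsHeightSeq (n : ℕ) (hs : List ℕ) : Set where
  field
    nonempty  : 1 ≤ length hs
    length≤n  : length hs ≤ n
    diagonal≤ : ∀ i → 1 ≤ i → i ≤ length hs → i ≤ hAt hs i
    monotone  : ∀ i i' → 1 ≤ i → i ≤ i' → i' ≤ length hs → hAt hs i ≤ hAt hs i'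
    lastHeight : LastHeight (2 * n) (length hs) (hAt hs (length hs))

Rising⇒IsHeightSeq : ∀ n → 1 ≤ n → ∀ hs e → Rising 0 0 (hs ∷ʳ e) →
  LastHeight (2 * n) (suc (length hs)) e → IsHeightSeq n (hs ∷ʳ e)
Rising⇒IsHeightSeq n 1≤n hs e ρ lastH = record
  { nonempty  = ≤-trans (s≤s z≤n) (≤-reflexive (sym (length-∷ʳ hs e)))
  ; length≤n  = subst (_≤ n) (sym (length-∷ʳ hs e))
                  (k≤2n∸k+1⇒k≤n n (suc (length hs)) 1≤n (≤-trans k≤e (LastHeight-≤ {2 * n} {suc (length hs)} lastH)))
  ; diagonal≤ = Rising-≥diag 0 0 (hs ∷ʳ e) ρ
  ; monotone  = Rising-mono 0 0 (hs ∷ʳ e) ρ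
  ; lastHeight = subst (λ k → LastHeight (2 * n) k (hAt (hs ∷ʳ e) k)) (sym (length-∷ʳ hs e))
                  (subst (LastHeight (2 * n) (suc (length hs))) (sym (hAt-∷ʳ-last hs e)) lastH)
  }
  where
  k≤e : suc (length hs) ≤ e
  k≤e = ≤-trans (Rising-≥diag 0 0 (hs ∷ʳ e) ρ (suc (length hs)) (s≤s z≤n) (≤-reflexive (sym (length-∷ʳ hs e))))
                (≤-reflexive (hAt-∷ʳ-last hs e))

heightSeq-isHeightSeq : ∀ n → 1 ≤ n → (p : DB n) → IsHeightSeq n (heightSeq (word p))
heightSeq-isHeightSeq n 1≤n (mkDB w len dyck) with initLast w
heightSeq-isHeightSeq (suc n) _ (mkDB .[] () dyck) | []
... | v ∷ʳ′ x rewrite heightSeq-∷ʳ v x =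
  Rising⇒IsHeightSeq n 1≤n (heightsR 0 v) (countU (v ∷ʳ x))
    (heightsR-rising 0 0 v x (prefixes⇒DyckFrom 0 (v ∷ʳ x) dyck))
    (subst₂ (λ N k → LastHeight N (suc k) (countU (v ∷ʳ x)))
       (trans (cong suc (sym (length≡countU+countR v))) (trans (sym (length-∷ʳ v x)) len))
       (sym (length-heightsR 0 v))
       (countU-∷ʳ v x))

-- Realising height sequences

lastOr : ℕ → List ℕ → ℕ
lastOr c []       = c
lastOr c (h ∷ hs) = lastOr h hs

wordOf : ℕ → List ℕ → ℕ → List Letter
wordOf c []       t = replicate t u
wordOf c (h ∷ hs) t = replicate (h ∸ c) u ++ r ∷ wordOf h hs t

heightsR-wordOf : ∀ j c hs t → Rising j c hs → heightsR c (wordOf c hs t) ≡ hs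
heightsR-wordOf j c []       t _ = heightsR-replicate c t
heightsR-wordOf j c (h ∷ hs) t (c≤h , _ , ρ)
  rewrite heightsR-++ c (replicate (h ∸ c) u) (r ∷ wordOf h hs t)
        | heightsR-replicate c (h ∸ c) | countU-replicate (h ∸ c) | m+[n∸m]≡n c≤h =
  cong (h ∷_) (heightsR-wordOf (suc j) h hs t ρ)

countU-wordOf : ∀ j c hs t → Rising j c hs → c + countU (wordOf c hs t) ≡ lastOr c hs + t
countU-wordOf j c []       t _ = cong (c +_) (countU-replicate t)
countU-wordOf j c (h ∷ hs) t (c≤h , _ , ρ)
  rewrite countU-++ (replicate (h ∸ c) u) (r ∷ wordOf h hs t) | countU-replicate (h ∸ c) = begin
    c + (h ∸ c + countU (wordOf h hs t))  ≡⟨ sym (+-assoc c (h ∸ c) _) ⟩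
    c + (h ∸ c) + countU (wordOf h hs t)  ≡⟨ cong (_+ countU (wordOf h hs t)) (m+[n∸m]≡n c≤h) ⟩
    h + countU (wordOf h hs t)            ≡⟨ countU-wordOf (suc j) h hs t ρ ⟩
    lastOr h hs + t                       ∎
  where open ≡-Reasoning

countR-wordOf : ∀ c hs t → countR (wordOf c hs t) ≡ length hs
countR-wordOf c []       t = countR-replicate t
countR-wordOf c (h ∷ hs) t
  rewrite countR-++ (replicate (h ∸ c) u) (r ∷ wordOf h hs t) | countR-replicate (h ∸ c) =
  cong suc (countR-wordOf h hs t)

DyckFrom-[r] : ∀ d → 1 ≤ d → DyckFrom d [ r ]
DyckFrom-[r] (suc d) _ = tt

-- j r's and c u's have been read, so the current height is c ∸ j.
wordOf-DyckFrom : ∀ j c hs t x → j ≤ c → Rising j c hs →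
  (x ≡ r → suc (j + length hs) ≤ lastOr c hs + t) → DyckFrom (c ∸ j) (wordOf c hs t ∷ʳ x)
wordOf-DyckFrom j c [] t u j≤c _ _ = DyckFrom-replicate t (c ∸ j) [ u ] tt
wordOf-DyckFrom j c [] t r j≤c _ enough = DyckFrom-replicate t (c ∸ j) [ r ] (DyckFrom-[r] _ (begin
    1              ≤⟨ m+n≤o⇒m≤o∸n 1 (≤-trans (≤-reflexive (cong suc (sym (+-identityʳ j)))) (enough refl)) ⟩
    c + t ∸ j      ≡⟨ +-∸-comm t j≤c ⟩
    c ∸ j + t      ≡⟨ +-comm (c ∸ j) t ⟩
    t + (c ∸ j)    ∎))
  where open ≤-Reasoning
wordOf-DyckFrom j c (h ∷ hs) t x j≤c (c≤h , j<h , ρ) enough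
  rewrite ++-assoc (replicate (h ∸ c) u) (r ∷ wordOf h hs t) [ x ] =
  DyckFrom-replicate (h ∸ c) (c ∸ j) _
    (subst (λ d → DyckFrom d (r ∷ (wordOf h hs t ∷ʳ x))) height
      (wordOf-DyckFrom (suc j) h hs t x j<h ρ λ x≡r →
        ≤-trans (≤-reflexive (cong suc (sym (+-suc j (length hs))))) (enough x≡r)))
  where
  open ≡-Reasoning
  height : suc (h ∸ suc j) ≡ h ∸ c + (c ∸ j)
  height = begin
    suc (h ∸ suc j)  ≡⟨ +-comm 1 _ ⟩
    h ∸ suc j + 1    ≡⟨ m∸[1+n]+1≡m∸n j<h ⟩
    h ∸ j            ≡⟨ cong (_∸ j) (sym (m∸n+n≡m c≤h)) ⟩
    h ∸ c + c ∸ j    ≡⟨ +-∸-assoc (h ∸ c) j≤c ⟩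
    h ∸ c + (c ∸ j)  ∎

wordOf-DB : ∀ n hs t x → Rising 0 0 hs → (x ≡ r → suc (length hs) ≤ lastOr 0 hs + t) →
  suc (lastOr 0 hs + t + length hs) ≡ 2 * n →
  Σ (DB n) λ p → heightSeq (word p) ≡ hs ∷ʳ (lastOr 0 hs + t + countU [ x ])
wordOf-DB n hs t x ρ enough len =
  mkDB w length-w (DyckFrom⇒prefixes 0 w (wordOf-DyckFrom 0 0 hs t x z≤n ρ enough)) , heights
  where
  open ≡-Reasoning
  v = wordOf 0 hs t
  w = v ∷ʳ x
  length-w : length w ≡ 2 * n
  length-w = begin
    length w                         ≡⟨ length-∷ʳ v x ⟩
    suc (length v)                   ≡⟨ cong suc (length≡countU+countR v) ⟩
    suc (countU v + countR v)        ≡⟨ cong₂ (λ a b → suc (a + b)) (countU-wordOf 0 0 hs t ρ) (countR-wordOf 0 hs t) ⟩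
    suc (lastOr 0 hs + t + length hs) ≡⟨ len ⟩
    2 * n                            ∎
  heights : heightSeq w ≡ hs ∷ʳ (lastOr 0 hs + t + countU [ x ])
  heights = begin
    heightSeq w                      ≡⟨ heightSeq-∷ʳ v x ⟩
    heightsR 0 v ∷ʳ countU w         ≡⟨ cong₂ _∷ʳ_ (heightsR-wordOf 0 0 hs t ρ) (countU-++ v [ x ]) ⟩
    hs ∷ʳ (countU v + countU [ x ])  ≡⟨ cong (λ e → hs ∷ʳ (e + countU [ x ])) (countU-wordOf 0 0 hs t ρ) ⟩
    hs ∷ʳ (lastOr 0 hs + t + countU [ x ]) ∎

tabulate₁ : (ℕ → ℕ) → ℕ → List ℕ
tabulate₁ f k = applyUpTo (λ i → f (suc i)) k

length-tabulate₁ : ∀ f k → length (tabulate₁ f k) ≡ k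
length-tabulate₁ f k = length-applyUpTo _ k

hAt-tabulate₁ : ∀ f k i → 1 ≤ i → i ≤ k → hAt (tabulate₁ f k) i ≡ f i
hAt-tabulate₁ f k (suc i) _ i<k = hAt-applyUpTo _ k i i<k

lastOr-applyUpTo : ∀ c g k → lastOr c (applyUpTo g (suc k)) ≡ g k
lastOr-applyUpTo c g zero    = refl
lastOr-applyUpTo c g (suc k) = lastOr-applyUpTo (g 0) (λ i → g (suc i)) k

lastOr-tabulate₁-≤ : ∀ f k e → (1 ≤ k → f k ≤ e) → lastOr 0 (tabulate₁ f k) ≤ e
lastOr-tabulate₁-≤ f zero    e _   = z≤n
lastOr-tabulate₁-≤ f (suc k) e f≤ = ≤-trans (≤-reflexive (lastOr-applyUpTo 0 (λ i → f (suc i)) k)) (f≤ (s≤s z≤n))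

realise : ∀ n f k → 1 ≤ k → k ≤ n →
  (∀ i → 1 ≤ i → i ≤ k → i ≤ f i) → (∀ i → 1 ≤ i → suc i ≤ k → f i ≤ f (suc i)) →
  LastHeight (2 * n) k (f k) → (2 ≤ k → f (k ∸ 1) ≤ 2 * n ∸ k) →
  Σ (DB n) λ p → heightSeq (word p) ≡ tabulate₁ f k
realise n f (suc k) _ k<n diag mono lastH prev = byLastLetter lastH
  where
  open ≡-Reasoning
  hs = tabulate₁ f k
  -- the number of u's before the last letter
  e = 2 * n ∸ suc k
  t = e ∸ lastOr 0 hs
  ρ : Rising 0 0 hs
  ρ = Rising-applyUpTo 0 0 _ k (λ _ → z≤n)
        (λ i i<k → diag (suc i) (s≤s z≤n) (≤-trans i<k (n≤1+n k)))
        (λ i i+1<k → mono (suc i) (s≤s z≤n) (≤-trans i+1<k (n≤1+n _)))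
  lastOr+t : lastOr 0 hs + t ≡ e
  lastOr+t = m+[n∸m]≡n (lastOr-tabulate₁-≤ f k e λ 1≤k → prev (s≤s 1≤k))
  length-ok : suc (lastOr 0 hs + t + length hs) ≡ 2 * n
  length-ok = begin
    suc (lastOr 0 hs + t + length hs) ≡⟨ cong₂ (λ a b → suc (a + b)) lastOr+t (length-tabulate₁ f k) ⟩
    suc (e + k)                       ≡⟨ sym (+-suc e k) ⟩
    e + suc k                         ≡⟨ m∸n+n≡m (≤-trans k<n (m≤m+n n _)) ⟩
    2 * n                             ∎
  build : ∀ x → (x ≡ r → suc k ≤ e) → e + countU [ x ] ≡ f (suc k) →
    Σ (DB n) λ p → heightSeq (word p) ≡ tabulate₁ f (suc k)
  build x enough final with wordOf-DB n hs t x ρ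
    (λ x≡r → subst₂ _≤_ (cong suc (sym (length-tabulate₁ f k))) (sym lastOr+t) (enough x≡r)) length-ok
  ... | p , heights = p , (begin
    heightSeq (word p)                      ≡⟨ heights ⟩
    hs ∷ʳ (lastOr 0 hs + t + countU [ x ])  ≡⟨ cong (λ h → hs ∷ʳ (h + countU [ x ])) lastOr+t ⟩
    hs ∷ʳ (e + countU [ x ])                ≡⟨ cong (hs ∷ʳ_) final ⟩
    hs ∷ʳ f (suc k)                         ≡⟨ applyUpTo-∷ʳ (λ i → f (suc i)) k ⟩
    tabulate₁ f (suc k)                     ∎)
  byLastLetter : LastHeight (2 * n) (suc k) (f (suc k)) → Σ (DB n) λ p → heightSeq (word p) ≡ tabulate₁ f (suc k)
  byLastLetter (inj₁ f≡) = build r (λ _ → ≤-trans (diag (suc k) (s≤s z≤n) ≤-refl) (≤-reflexive f≡))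
                                   (trans (+-identityʳ e) (sym f≡))
  byLastLetter (inj₂ f≡) = build u (λ ()) (sym f≡)

Dominated : List ℕ → List ℕ → Set
Dominated a b = length b ≤ length a × (∀ i → 1 ≤ i → i ≤ length b → hAt a i ≤ hAt b i)

DomSeq⇒Dominated : ∀ a b → DomSeq a b → Dominated a b
DomSeq⇒Dominated a       []      dom-[]          = z≤n , λ { (suc i) _ () }
DomSeq⇒Dominated (x ∷ a) (y ∷ b) (dom-∷ x≤y a≤b) = s≤s (proj₁ a≤b′) , pointwise
  where
  a≤b′ = DomSeq⇒Dominated a b a≤b
  pointwise : ∀ i → 1 ≤ i → i ≤ suc (length b) → hAt (x ∷ a) i ≤ hAt (y ∷ b) i
  pointwise (suc zero)    _ _        = x≤y
  pointwise (suc (suc i)) _ (s≤s i≤) = proj₂ a≤b′ (suc i) (s≤s z≤n) i≤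

Dominated⇒DomSeq : ∀ a b → Dominated a b → DomSeq a b
Dominated⇒DomSeq a       []      _                     = dom-[]
Dominated⇒DomSeq (x ∷ a) (y ∷ b) (s≤s len≤ , pointwise) =
  dom-∷ (pointwise 1 (s≤s z≤n) (s≤s z≤n))
        (Dominated⇒DomSeq a b (len≤ , λ { (suc i) _ i≤ → pointwise (suc (suc i)) (s≤s z≤n) (s≤s i≤) }))

DomSeq-antisym : ∀ a b → DomSeq a b → DomSeq b a → a ≡ b
DomSeq-antisym []      []      _                _                = refl
DomSeq-antisym (x ∷ a) (y ∷ b) (dom-∷ x≤y a≤b) (dom-∷ y≤x b≤a) =
  cong₂ _∷_ (≤-antisym x≤y y≤x) (DomSeq-antisym a b a≤b b≤a)

-- The least t ∈ [j, j + d] with S t, or j + d if there is none.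
nextTrue : (ℕ → Bool) → ℕ → ℕ → ℕ
nextTrue S j zero    = j
nextTrue S j (suc d) = if S j then j else nextTrue S (suc j) d

nextTrue-≥ : ∀ S j d → j ≤ nextTrue S j d
nextTrue-≥ S j zero    = ≤-refl
nextTrue-≥ S j (suc d) with S j
... | true  = ≤-refl
... | false = ≤-trans (n≤1+n j) (nextTrue-≥ S (suc j) d)

nextTrue-≤ : ∀ S j d → nextTrue S j d ≤ j + d
nextTrue-≤ S j zero    = ≤-reflexive (sym (+-identityʳ j))
nextTrue-≤ S j (suc d) with S j
... | true  = m≤m+n j _
... | false = ≤-trans (nextTrue-≤ S (suc j) d) (≤-reflexive (sym (+-suc j d)))

nextTrue-true : ∀ (S : ℕ → Bool) j d → S (j + d) ≡ true → S (nextTrue S j d) ≡ true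
nextTrue-true S j zero    S[j+d] = trans (cong S (sym (+-identityʳ j))) S[j+d]
nextTrue-true S j (suc d) S[j+d] with S j in Sj
... | true  = Sj
... | false = nextTrue-true S (suc j) d (trans (cong S (sym (+-suc j d))) S[j+d])

nextTrue-least : ∀ S j d t → j ≤ t → t < nextTrue S j d → S t ≡ false
nextTrue-least S j zero    t j≤t t< = ⊥-elim (<⇒≱ t< j≤t)
nextTrue-least S j (suc d) t j≤t t< with S j in Sj
... | true  = ⊥-elim (<⇒≱ t< j≤t)
... | false with m≤n⇒m<n∨m≡n j≤t
...   | inj₂ refl = Sj
...   | inj₁ j<t  = nextTrue-least S (suc j) d t j<t t<

nextTrue-mono : ∀ S j d → nextTrue S j (suc d) ≤ nextTrue S (suc j) d
nextTrue-mono S j d with S j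
... | true  = ≤-trans (n≤1+n j) (nextTrue-≥ S (suc j) d)
... | false = ≤-refl

maxTrue : (ℕ → Bool) → ℕ → ℕ
maxTrue S zero    = 0
maxTrue S (suc a) = if S (suc a) then suc a else maxTrue S a

maxTrue-≤ : ∀ S a → maxTrue S a ≤ a
maxTrue-≤ S zero    = z≤n
maxTrue-≤ S (suc a) with S (suc a)
... | true  = ≤-refl
... | false = ≤-trans (maxTrue-≤ S a) (n≤1+n a)

maxTrue-true : ∀ S a → 1 ≤ maxTrue S a → S (maxTrue S a) ≡ true
maxTrue-true S (suc a) 1≤ with S (suc a) in Sa
... | true  = Sa
... | false = maxTrue-true S a 1≤

maxTrue-greatest : ∀ S a i → 1 ≤ i → i ≤ a → S i ≡ true → i ≤ maxTrue S a
maxTrue-greatest S zero    (suc i) _ () _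
maxTrue-greatest S (suc a) i 1≤i i≤ Si with S (suc a) in Sa
... | true  = i≤
... | false with m≤n⇒m<n∨m≡n i≤
...   | inj₁ i<  = maxTrue-greatest S a i 1≤i (≤-pred i<) Si
...   | inj₂ refl with () ← trans (sym Sa) Si

NextIn : (ℕ → Bool) → ℕ → ℕ → ℕ → Set
NextIn S j c m = j ≤ c × c ≤ m × S c ≡ true × (∀ t → j ≤ t → t < c → S t ≡ false)

NextIn-unique : ∀ {S j c c' m m'} → NextIn S j c m → NextIn S j c' m' → c ≡ c'
NextIn-unique {S} {c = c} {c'} (j≤c , _ , Sc , c-least) (j≤c' , _ , Sc' , c'-least) with <-cmp c c'
... | tri≈ _ c≡c' _ = c≡c'
... | tri< c<c' _ _ with () ← trans (sym Sc) (c'-least c j≤c c<c')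
... | tri> _ _ c'<c with () ← trans (sym Sc') (c-least c' j≤c' c'<c)

NextIn-self : ∀ {S j m} → S j ≡ true → j ≤ m → NextIn S j j m
NextIn-self Sj j≤m = ≤-refl , j≤m , Sj , λ t j≤t t<j → ⊥-elim (<⇒≱ t<j j≤t)

NextIn-shift : ∀ {S i j c m} → NextIn S i c m → i ≤ j → j ≤ c → NextIn S j c m
NextIn-shift (_ , c≤m , Sc , c-least) i≤j j≤c = j≤c , c≤m , Sc , λ t j≤t t<c → c-least t (≤-trans i≤j j≤t) t<c

nextTrue-NextIn : ∀ S j m → j ≤ m → S m ≡ true → NextIn S j (nextTrue S j (m ∸ j)) m
nextTrue-NextIn S j m j≤m Sm =
  nextTrue-≥ S j (m ∸ j) ,
  ≤-trans (nextTrue-≤ S j (m ∸ j)) (≤-reflexive (m+[n∸m]≡n j≤m)) ,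
  nextTrue-true S j (m ∸ j) (trans (cong S (m+[n∸m]≡n j≤m)) Sm) ,
  nextTrue-least S j (m ∸ j)

-- Fixed points and atoms

Fixes : List ℕ → ℕ → Set
Fixes hs i = hAt hs i ≡ i

isFixed : List ℕ → ℕ → Bool
isFixed hs i = hAt hs i ≡ᵇ i

isFixed⇒Fixes : ∀ hs i → isFixed hs i ≡ true → Fixes hs i
isFixed⇒Fixes hs i isF = ≡ᵇ⇒≡ (hAt hs i) i (Equivalence.from T-≡ isF)

Fixes⇒isFixed : ∀ hs i → Fixes hs i → isFixed hs i ≡ true
Fixes⇒isFixed hs i fixed = Equivalence.to T-≡ (≡⇒≡ᵇ (hAt hs i) i fixed)

¬Fixes⇒isFixed : ∀ hs i → ¬ Fixes hs i → isFixed hs i ≡ false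
¬Fixes⇒isFixed hs i unfixed = ¬-not (λ isF → unfixed (isFixed⇒Fixes hs i isF))

isUnfixed : List ℕ → ℕ → Bool
isUnfixed hs i = not (isFixed hs i)

isUnfixed⇒¬Fixes : ∀ hs i → isUnfixed hs i ≡ true → ¬ Fixes hs i
isUnfixed⇒¬Fixes hs i isU fixed = not-¬ refl (trans (Fixes⇒isFixed hs i fixed) (sym isU))

¬Fixes⇒isUnfixed : ∀ hs i → ¬ Fixes hs i → isUnfixed hs i ≡ true
¬Fixes⇒isUnfixed hs i unfixed = cong not (¬Fixes⇒isFixed hs i unfixed)

suc[k∸1]≡k : ∀ {k} → 1 ≤ k → suc (k ∸ 1) ≡ k
suc[k∸1]≡k (s≤s _) = refl

-- The heights of the atom of D_n^B at position i: the identity raised by one at i.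
bump : ℕ → ℕ → ℕ
bump i j with j ≟ i
... | yes _ = suc j
... | no  _ = j

bump-≥ : ∀ i j → j ≤ bump i j
bump-≥ i j with j ≟ i
... | yes _ = n≤1+n j
... | no  _ = ≤-refl

bump-≤ : ∀ i j → bump i j ≤ suc j
bump-≤ i j with j ≟ i
... | yes _ = ≤-refl
... | no  _ = n≤1+n j

bump-mono : ∀ i j → bump i j ≤ bump i (suc j)
bump-mono i j with j ≟ i | suc j ≟ i
... | yes refl | yes j+1≡j = ⊥-elim (1+n≢n j+1≡j)
... | yes _    | no  _     = ≤-refl
... | no  _    | yes _     = ≤-trans (n≤1+n j) (n≤1+n (suc j))
... | no  _    | no  _     = n≤1+n j

bump-at : ∀ i → bump i i ≡ suc i
bump-at i with i ≟ i
... | yes _ = refl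
... | no i≢i = ⊥-elim (i≢i refl)

module _ (n : ℕ) (1≤n : 1 ≤ n) where

  heights : DB n → List ℕ
  heights p = heightSeq (word p)

  shape : (p : DB n) → IsHeightSeq n (heights p)
  shape = heightSeq-isHeightSeq n 1≤n

  fixesAll⇒IsBottom : ∀ y → (∀ i → 1 ≤ i → i ≤ n → Fixes (heights y) i) → IsBottom y
  fixesAll⇒IsBottom y fixes q = Dominated⇒DomSeq (heights y) (heights q)
    ( ≤-trans (IsHeightSeq.length≤n (shape q)) (fixed⇒≤length (heights y) n 1≤n (fixes n 1≤n ≤-refl))
    , λ i 1≤i i≤ → ≤-trans (≤-reflexive (fixes i 1≤i (≤-trans i≤ (IsHeightSeq.length≤n (shape q)))))
                           (IsHeightSeq.diagonal≤ (shape q) i 1≤i i≤))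

  Fixes-antitone : ∀ y x i → y ≤D x → 1 ≤ i → Fixes (heights x) i → Fixes (heights y) i
  Fixes-antitone y x i y≤x 1≤i fixed = ≤-antisym
    (≤-trans (pointwise i 1≤i i≤) (≤-reflexive fixed))
    (IsHeightSeq.diagonal≤ (shape y) i 1≤i (≤-trans i≤ len≤))
    where
    open Σ (DomSeq⇒Dominated (heights y) (heights x) y≤x) renaming (proj₁ to len≤; proj₂ to pointwise)
    i≤ = fixed⇒≤length (heights x) i 1≤i fixed

  2n∸n : 2 * n ∸ n ≡ n
  2n∸n = 2*n∸n≡n n

  bottom′ : Σ (DB n) λ p → heights p ≡ tabulate₁ (λ j → j) n
  bottom′ = realise n (λ j → j) n 1≤n ≤-refl (λ _ _ _ → ≤-refl) (λ i _ _ → n≤1+n i)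
    (inj₁ (sym 2n∸n)) (λ _ → ≤-trans (m∸n≤m n 1) (≤-reflexive (sym 2n∸n)))

  bottom : DB n
  bottom = proj₁ bottom′

  atom′ : ∀ i → Σ (DB n) λ p → heights p ≡ tabulate₁ (bump i) n
  atom′ i = realise n (bump i) n 1≤n ≤-refl (λ j _ _ → bump-≥ i j) (λ j _ _ → bump-mono i j) lastH
    (λ _ → ≤-trans (bump-≤ i (n ∸ 1)) (≤-reflexive (trans (suc[k∸1]≡k 1≤n) (sym 2n∸n))))
    where
    lastH : LastHeight (2 * n) n (bump i n)
    lastH with n ≟ i
    ... | yes _ = inj₂ (trans (+-comm 1 n) (cong (_+ 1) (sym 2n∸n)))
    ... | no  _ = inj₁ (sym 2n∸n)

  atom : ℕ → DB n
  atom i = proj₁ (atom′ i)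

  hAt-atom : ∀ i j → 1 ≤ j → j ≤ n → hAt (heights (atom i)) j ≡ bump i j
  hAt-atom i j 1≤j j≤n = trans (cong (λ hs → hAt hs j) (proj₂ (atom′ i))) (hAt-tabulate₁ (bump i) n j 1≤j j≤n)

  atom-≤D : ∀ i y → ¬ Fixes (heights y) i → atom i ≤D y
  atom-≤D i y unfixed = Dominated⇒DomSeq (heights (atom i)) (heights y)
    ( ≤-trans (IsHeightSeq.length≤n (shape y))
              (≤-reflexive (sym (trans (cong length (proj₂ (atom′ i))) (length-tabulate₁ (bump i) n))))
    , λ j 1≤j j≤ → ≤-trans (≤-reflexive (hAt-atom i j 1≤j (≤-trans j≤ (IsHeightSeq.length≤n (shape y)))))
                           (bumped j 1≤j j≤))
    where
    bumped : ∀ j → 1 ≤ j → j ≤ length (heights y) → bump i j ≤ hAt (heights y) j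
    bumped j 1≤j j≤ with j ≟ i
    ... | yes refl = ≤∧≢⇒< (IsHeightSeq.diagonal≤ (shape y) j 1≤j j≤) (λ j≡h → unfixed (sym j≡h))
    ... | no  _    = IsHeightSeq.diagonal≤ (shape y) j 1≤j j≤

  atom≰bottom : ∀ i → 1 ≤ i → i ≤ n → ¬ (atom i ≤D bottom)
  atom≰bottom i 1≤i i≤n atom≤bottom = <-irrefl refl (begin-strict
    i                            <⟨ ≤-reflexive (sym (bump-at i)) ⟩
    bump i i                     ≡⟨ sym (hAt-atom i i 1≤i i≤n) ⟩
    hAt (heights (atom i)) i     ≤⟨ proj₂ (DomSeq⇒Dominated _ _ atom≤bottom) i 1≤i i≤length ⟩
    hAt (heights bottom) i       ≡⟨ cong (λ hs → hAt hs i) (proj₂ bottom′) ⟩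
    hAt (tabulate₁ (λ j → j) n) i ≡⟨ hAt-tabulate₁ (λ j → j) n i 1≤i i≤n ⟩
    i                            ∎)
    where
    open ≤-Reasoning
    i≤length : i ≤ length (heights bottom)
    i≤length = ≤-trans i≤n (≤-reflexive (sym (trans (cong length (proj₂ bottom′)) (length-tabulate₁ (λ j → j) n))))

  FixCover : DB n → DB n → Set
  FixCover x z = ∀ i → 1 ≤ i → i ≤ n → Fixes (heights x) i ⊎ Fixes (heights z) i

  -- Otherwise the atom raising position i lies below both x and z.
  Disjoint⇒fixes : ∀ x z → MeetIsBottom x z → ∀ i → 1 ≤ i → i ≤ n →
    ¬ Fixes (heights x) i → Fixes (heights z) i
  Disjoint⇒fixes x z disjoint i 1≤i i≤n x-unfixed with hAt (heights z) i ≟ i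
  ... | yes z-fixes  = z-fixes
  ... | no  z-unfixed =
    ⊥-elim (atom≰bottom i 1≤i i≤n (disjoint (atom i) (atom-≤D i x x-unfixed) (atom-≤D i z z-unfixed) bottom))

  FixCover⇒Disjoint : ∀ x z → FixCover x z → MeetIsBottom x z
  FixCover⇒Disjoint x z cover y y≤x y≤z = fixesAll⇒IsBottom y λ i 1≤i i≤n →
    [ Fixes-antitone y x i y≤x 1≤i , Fixes-antitone y z i y≤z 1≤i ]′ (cover i 1≤i i≤n)

  -- The greatest path with prescribed fixed points

  -- m is the largest element of S ∩ [1, n], or 0 if there is none.
  IsMaxOf : (ℕ → Bool) → ℕ → Set
  IsMaxOf S m = m ≤ n × (1 ≤ m → S m ≡ true) × (∀ i → 1 ≤ i → i ≤ n → S i ≡ true → i ≤ m)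

  -- The heights of the greatest path fixing S ∩ [1, n]: with top = max (S ∩ [1, n]), h_j is the
  -- least element of S from j on for j ≤ top; if top < n, one last height 2n − top follows.
  record Canonical (S : ℕ → Bool) (hs : List ℕ) : Set where
    field
      top     : ℕ
      top-max : IsMaxOf S top
      ending  : (top ≡ n × length hs ≡ n) ⊎ (top < n × length hs ≡ suc top × hAt hs (suc top) ≡ 2 * n ∸ top)
      next    : ∀ j → 1 ≤ j → j ≤ top → NextIn S j (hAt hs j) top

  Canonical-fixes : ∀ S hs → Canonical S hs → ∀ i → 1 ≤ i → i ≤ n → S i ≡ true → Fixes hs i
  Canonical-fixes S hs can i 1≤i i≤n Si = NextIn-unique (next i 1≤i i≤top) (NextIn-self Si i≤top)
    where
    open Canonical can
    i≤top = proj₂ (proj₂ top-max) i 1≤i i≤n Si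

  Canonical-fixed⇒true : ∀ S hs → Canonical S hs → ∀ i → 1 ≤ i → i ≤ n → Fixes hs i → S i ≡ true
  Canonical-fixed⇒true S hs can i 1≤i i≤n fixed with i ≤? Canonical.top can
  ... | yes i≤top = subst (λ c → S c ≡ true) fixed (proj₁ (proj₂ (proj₂ (Canonical.next can i 1≤i i≤top))))
  ... | no  i≰top with Canonical.ending can
  ...   | inj₁ (refl , _) = ⊥-elim (i≰top i≤n)
  ...   | inj₂ (top<n , len≡ , last≡) with m≤n⇒m<n∨m≡n (≰⇒> i≰top)
  ...     | inj₂ refl = ⊥-elim (2n∸k+1≢k n i 1≤n
                      (trans (2n∸[1+m]+1≡2n∸m n top<n) (trans (sym last≡) fixed)))
  ...     | inj₁ top+1<i =
    ⊥-elim (<⇒≢ 1≤i (trans (sym (hAt-beyond hs i (≤-trans (s≤s (≤-reflexive len≡)) top+1<i))) fixed))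

  -- The last height of a path with m < n heights is 2n − m or 2n − m + 1, never m.
  fixes⇒length> : ∀ z m → m < n → (1 ≤ m → Fixes (heights z) m) → m < length (heights z)
  fixes⇒length> z zero    _   _     = IsHeightSeq.nonempty (shape z)
  fixes⇒length> z (suc m) m<n fixed = ≤∧≢⇒< (fixed⇒≤length (heights z) (suc m) (s≤s z≤n) fm) last-unfixed
    where
    fm = fixed (s≤s z≤n)
    last-unfixed : suc m ≢ length (heights z)
    last-unfixed k≡ with subst (λ k → LastHeight (2 * n) k (hAt (heights z) k)) (sym k≡) (IsHeightSeq.lastHeight (shape z))
    ... | inj₁ h≡ = k<n⇒2n∸k≢k n (suc m) m<n (trans (sym h≡) fm)
    ... | inj₂ h≡ = 2n∸k+1≢k n (suc m) 1≤n (trans (sym h≡) fm)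

  height≤fixed : ∀ z j c → 1 ≤ j → j ≤ c → Fixes (heights z) c → hAt (heights z) j ≤ c
  height≤fixed z j c 1≤j j≤c fixed =
    ≤-trans (IsHeightSeq.monotone (shape z) j c 1≤j j≤c (fixed⇒≤length _ c (≤-trans 1≤j j≤c) fixed)) (≤-reflexive fixed)

  Canonical-greatest : ∀ S hs → Canonical S hs → ∀ z →
    (∀ i → 1 ≤ i → i ≤ n → S i ≡ true → Fixes (heights z) i) → DomSeq (heights z) hs
  Canonical-greatest S hs can z fixesS = Dominated⇒DomSeq (heights z) hs (length≤ , pointwise)
    where
    open Canonical can
    fixesTop : 1 ≤ top → Fixes (heights z) top
    fixesTop 1≤top = fixesS top 1≤top (proj₁ top-max) (proj₁ (proj₂ top-max) 1≤top)
    length≤ : length hs ≤ length (heights z)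
    length≤ with ending
    ... | inj₁ (refl , len≡)      = ≤-trans (≤-reflexive len≡) (fixed⇒≤length _ top 1≤n (fixesTop 1≤n))
    ... | inj₂ (top<n , len≡ , _) = ≤-trans (≤-reflexive len≡) (fixes⇒length> z top top<n fixesTop)
    pointwise : ∀ j → 1 ≤ j → j ≤ length hs → hAt (heights z) j ≤ hAt hs j
    pointwise j 1≤j j≤ with j ≤? top
    ... | yes j≤top = let (j≤c , c≤top , Sc , _) = next j 1≤j j≤top in
      height≤fixed z j _ 1≤j j≤c (fixesS _ (≤-trans 1≤j j≤c) (≤-trans c≤top (proj₁ top-max)) Sc)
    ... | no j≰top with ending
    ...   | inj₁ (refl , len≡) = ⊥-elim (j≰top (≤-trans j≤ (≤-reflexive len≡)))
    ...   | inj₂ (top<n , len≡ , last≡) with ≤-antisym (≤-trans j≤ (≤-reflexive len≡)) (≰⇒> j≰top)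
    ...     | refl = begin
      hAt (heights z) (suc top)  ≤⟨ IsHeightSeq.monotone (shape z) (suc top) k 1≤j top<k ≤-refl ⟩
      hAt (heights z) k          ≤⟨ LastHeight-≤ {2 * n} {k} (IsHeightSeq.lastHeight (shape z)) ⟩
      2 * n ∸ k + 1              ≤⟨ 2n∸k+1≤2n∸m n top k top<k (IsHeightSeq.length≤n (shape z)) ⟩
      2 * n ∸ top                ≡⟨ sym last≡ ⟩
      hAt hs (suc top)           ∎
      where
      open ≤-Reasoning
      k = length (heights z)
      top<k = fixes⇒length> z top top<n fixesTop

  canonicalHeight : (ℕ → Bool) → ℕ → ℕ → ℕ
  canonicalHeight S m j with j ≤? m
  ... | yes _ = nextTrue S j (m ∸ j)
  ... | no  _ = 2 * n ∸ m

  canonicalHeight-≤ : ∀ S m j → j ≤ m → canonicalHeight S m j ≡ nextTrue S j (m ∸ j)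
  canonicalHeight-≤ S m j j≤m with j ≤? m
  ... | yes _   = refl
  ... | no  j≰m = ⊥-elim (j≰m j≤m)

  canonicalHeight-> : ∀ S m j → m < j → canonicalHeight S m j ≡ 2 * n ∸ m
  canonicalHeight-> S m j m<j with j ≤? m
  ... | yes j≤m = ⊥-elim (<⇒≱ m<j j≤m)
  ... | no  _   = refl

  canonicalHeight-≥ : ∀ S m j → j ≤ m → j ≤ canonicalHeight S m j
  canonicalHeight-≥ S m j j≤m = subst (j ≤_) (sym (canonicalHeight-≤ S m j j≤m)) (nextTrue-≥ S j (m ∸ j))

  canonicalHeight-≤top : ∀ S m j → j ≤ m → canonicalHeight S m j ≤ m
  canonicalHeight-≤top S m j j≤m = subst (_≤ m) (sym (canonicalHeight-≤ S m j j≤m))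
    (≤-trans (nextTrue-≤ S j (m ∸ j)) (≤-reflexive (m+[n∸m]≡n j≤m)))

  canonicalHeight-top : ∀ S m → canonicalHeight S m m ≡ m
  canonicalHeight-top S m = trans (canonicalHeight-≤ S m m ≤-refl) (cong (nextTrue S m) (n∸n≡0 m))

  canonicalHeight-mono : ∀ S m j → suc j ≤ m → canonicalHeight S m j ≤ canonicalHeight S m (suc j)
  canonicalHeight-mono S m j j<m
    rewrite canonicalHeight-≤ S m j (<⇒≤ j<m) | canonicalHeight-≤ S m (suc j) j<m
          | sym (m∸[1+n]+1≡m∸n j<m) | +-comm (m ∸ suc j) 1 = nextTrue-mono S j (m ∸ suc j)

  hAt-canonical-NextIn : ∀ S m k → m ≤ k → (1 ≤ m → S m ≡ true) →
    ∀ j → 1 ≤ j → j ≤ m → NextIn S j (hAt (tabulate₁ (canonicalHeight S m) k) j) m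
  hAt-canonical-NextIn S m k m≤k Sm j 1≤j j≤m =
    subst (λ c → NextIn S j c m)
      (sym (trans (hAt-tabulate₁ (canonicalHeight S m) k j 1≤j (≤-trans j≤m m≤k)) (canonicalHeight-≤ S m j j≤m)))
      (nextTrue-NextIn S j m j≤m (Sm (≤-trans 1≤j j≤m)))

  canonical-of-max : ∀ S m → IsMaxOf S m → Σ (DB n) λ p → Canonical S (heights p)
  canonical-of-max S m max@(m≤n , Sm , _) with m <? n
  ... | yes m<n = let (p , p≡) = path in p , subst (Canonical S) (sym p≡) (record
      { top = m ; top-max = max
      ; ending = inj₂ (m<n , length-tabulate₁ (canonicalHeight S m) (suc m) ,
                       trans (hAt-tabulate₁ (canonicalHeight S m) (suc m) (suc m) (s≤s z≤n) ≤-refl)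
                             (canonicalHeight-> S m (suc m) ≤-refl))
      ; next = hAt-canonical-NextIn S m (suc m) (n≤1+n m) Sm })
    where
    path : Σ (DB n) λ p → heights p ≡ tabulate₁ (canonicalHeight S m) (suc m)
    path = realise n (canonicalHeight S m) (suc m) (s≤s z≤n) m<n diag mono
      (inj₂ (trans (canonicalHeight-> S m (suc m) ≤-refl) (sym (2n∸[1+m]+1≡2n∸m n m<n))))
      (λ _ → ≤-trans (≤-reflexive (canonicalHeight-top S m)) (m<n⇒m≤2n∸[1+m] n m m<n))
      where
      after = canonicalHeight-> S m (suc m) ≤-refl
      diag : ∀ j → 1 ≤ j → j ≤ suc m → j ≤ canonicalHeight S m j
      diag j _ j≤ with m≤n⇒m<n∨m≡n j≤
      ... | inj₁ j≤m = canonicalHeight-≥ S m j (≤-pred j≤m)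
      ... | inj₂ refl = ≤-trans (m<n⇒1+m≤2n∸m n m m<n) (≤-reflexive (sym after))
      mono : ∀ j → 1 ≤ j → suc j ≤ suc m → canonicalHeight S m j ≤ canonicalHeight S m (suc j)
      mono j _ j<≤ with m≤n⇒m<n∨m≡n (≤-pred j<≤)
      ... | inj₁ j<m = canonicalHeight-mono S m j j<m
      ... | inj₂ refl = ≤-trans (≤-reflexive (canonicalHeight-top S j))
                          (≤-trans (≤-trans (n≤1+n j) (m<n⇒1+m≤2n∸m n j m<n)) (≤-reflexive (sym after)))
  ... | no m≮n with ≤-antisym m≤n (≮⇒≥ m≮n)
  ...   | refl = let (p , p≡) = path in p , subst (Canonical S) (sym p≡) (record
      { top = n ; top-max = max
      ; ending = inj₁ (refl , length-tabulate₁ (canonicalHeight S n) n)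
      ; next = hAt-canonical-NextIn S n n ≤-refl Sm })
    where
    path : Σ (DB n) λ p → heights p ≡ tabulate₁ (canonicalHeight S n) n
    path = realise n (canonicalHeight S n) n 1≤n ≤-refl
      (λ j _ j≤n → canonicalHeight-≥ S n j j≤n) (λ j _ j<n → canonicalHeight-mono S n j j<n)
      (inj₁ (trans (canonicalHeight-top S n) (sym 2n∸n)))
      (λ _ → ≤-trans (canonicalHeight-≤top S n (n ∸ 1) (m∸n≤m n 1)) (≤-reflexive (sym 2n∸n)))

  canonical : ∀ S → Σ (DB n) λ p → Canonical S (heights p)
  canonical S = canonical-of-max S (maxTrue S n) (maxTrue-≤ S n , maxTrue-true S n , maxTrue-greatest S n)

  Canonical-top-fixed : ∀ S hs (can : Canonical S hs) → Fixes hs (Canonical.top can)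
  Canonical-top-fixed S hs can with Canonical.top can | Canonical.next can
  ... | zero    | _    = refl
  ... | suc top | next = let (top≤c , c≤top , _) = next (suc top) (s≤s z≤n) ≤-refl in ≤-antisym c≤top top≤c

  Canonical-block : ∀ S hs (can : Canonical S hs) → ∀ M → M ≤ Canonical.top can →
    Canonical.top can ≤ length hs → BlockCond hs M
  Canonical-block S hs can M M≤top top≤len i 1≤i i≤M with hAt hs i ≟ i
  ... | yes fixed   = inj₁ fixed
  ... | no  unfixed = inj₂ (≤∧≢⇒< i≤c (λ i≡c → unfixed (sym i≡c)) , ≤-trans c≤top top≤len , flat)
    where
    open Canonical can
    nextᵢ = next i 1≤i (≤-trans i≤M M≤top)
    i≤c = proj₁ nextᵢ
    c≤top = proj₁ (proj₂ nextᵢ)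
    flat : ∀ j → i ≤ j → j ≤ hAt hs i → hAt hs j ≡ hAt hs i
    flat j i≤j j≤c = NextIn-unique (next j (≤-trans 1≤i i≤j) (≤-trans j≤c c≤top)) (NextIn-shift nextᵢ i≤j j≤c)

  Canonical⇒Cond : ∀ S hs → Canonical S hs → Cond1 n hs ⊎ Cond2 n hs
  Canonical⇒Cond S hs can with Canonical.ending can
  ... | inj₁ (top≡n , len≡) = inj₁
    ( subst (λ k → hAt hs k ≡ n) (sym len≡) (subst (λ t → hAt hs t ≡ t) top≡n (Canonical-top-fixed S hs can))
    , Canonical-block S hs can (length hs ∸ 1)
        (≤-trans (∸-monoˡ-≤ 1 (≤-reflexive len≡)) (≤-trans (m∸n≤m n 1) (≤-reflexive (sym top≡n))))
        (≤-reflexive (trans top≡n (sym len≡))) )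
  ... | inj₂ (top<n , len≡ , last≡) = inj₂
    ( subst (λ k → hAt hs k ≡ 2 * n ∸ k + 1) (sym len≡) (trans last≡ (sym (2n∸[1+m]+1≡2n∸m n top<n)))
    , subst (λ k → hAt hs (k ∸ 1) ≡ k ∸ 1) (sym len≡) (Canonical-top-fixed S hs can)
    , subst (λ k → BlockCond hs (k ∸ 2)) (sym len≡)
        (Canonical-block S hs can (Canonical.top can ∸ 1) (m∸n≤m _ 1) (≤-trans (n≤1+n _) (≤-reflexive (sym len≡)))) )

  Fixes⇒NextIn : ∀ hs j m → Fixes hs j → j ≤ m → NextIn (isFixed hs) j (hAt hs j) m
  Fixes⇒NextIn hs j m fixed j≤m =
    subst (λ c → NextIn (isFixed hs) j c m) (sym fixed) (NextIn-self (Fixes⇒isFixed hs j fixed) j≤m)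

  BlockCond⇒NextIn : ∀ hs M m j → BlockCond hs M → 1 ≤ j → j ≤ M → j ≤ m →
    (∀ c → j < c → c ≤ length hs → Fixes hs c → c ≤ m) → NextIn (isFixed hs) j (hAt hs j) m
  BlockCond⇒NextIn hs M m j block 1≤j j≤M j≤m bound with block j 1≤j j≤M
  ... | inj₁ fixed = Fixes⇒NextIn hs j m fixed j≤m
  ... | inj₂ (j<c , c≤len , flat) =
    <⇒≤ j<c , bound _ j<c c≤len c-fixed , Fixes⇒isFixed hs _ c-fixed ,
    λ t j≤t t<c → ¬Fixes⇒isFixed hs t (λ t-fixed → <-irrefl (trans (sym t-fixed) (flat t j≤t (<⇒≤ t<c))) t<c)
    where
    c-fixed = flat (hAt hs j) (<⇒≤ j<c) ≤-refl

  j≤m∧j≰m∸1⇒j≡m : ∀ {j m} → 1 ≤ j → j ≤ m → j ≰ m ∸ 1 → j ≡ m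
  j≤m∧j≰m∸1⇒j≡m 1≤j j≤m j≰ =
    ≤-antisym j≤m (≤-trans (≤-reflexive (sym (suc[k∸1]≡k (≤-trans 1≤j j≤m)))) (≰⇒> j≰))

  LastHeight-n⇒k≡n : ∀ k → k ≤ n → LastHeight (2 * n) k n → k ≡ n
  LastHeight-n⇒k≡n k k≤n (inj₁ n≡) = n≡2n∸k⇒k≡n n k k≤n n≡
  LastHeight-n⇒k≡n k k≤n (inj₂ n≡) = ⊥-elim (k≤n⇒n≢2n∸k+1 n k k≤n n≡)

  Cond1⇒Canonical : ∀ hs → IsHeightSeq n hs → Cond1 n hs → Canonical (isFixed hs) hs
  Cond1⇒Canonical hs shp (last≡n , block) = record
    { top = n
    ; top-max = ≤-refl , (λ _ → Fixes⇒isFixed hs n n-fixed) , (λ _ _ i≤n _ → i≤n)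
    ; ending = inj₁ (refl , len≡n)
    ; next = next }
    where
    len≡n : length hs ≡ n
    len≡n = LastHeight-n⇒k≡n (length hs) (IsHeightSeq.length≤n shp)
              (subst (LastHeight (2 * n) (length hs)) last≡n (IsHeightSeq.lastHeight shp))
    n-fixed : Fixes hs n
    n-fixed = subst (λ k → hAt hs k ≡ n) len≡n last≡n
    next : ∀ j → 1 ≤ j → j ≤ n → NextIn (isFixed hs) j (hAt hs j) n
    next j 1≤j j≤n with j ≤? length hs ∸ 1
    ... | yes j≤M = BlockCond⇒NextIn hs _ n j block 1≤j j≤M j≤n (λ c _ c≤len _ → ≤-trans c≤len (≤-reflexive len≡n))
    ... | no  j≰M with trans (j≤m∧j≰m∸1⇒j≡m 1≤j (≤-trans j≤n (≤-reflexive (sym len≡n))) j≰M) len≡n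
    ...   | refl = Fixes⇒NextIn hs n n n-fixed ≤-refl

  Cond2⇒Canonical : ∀ hs → IsHeightSeq n hs → Cond2 n hs → Canonical (isFixed hs) hs
  Cond2⇒Canonical hs shp (last≡ , top-fixed , block) = record
    { top = top
    ; top-max = <⇒≤ top<n , (λ _ → Fixes⇒isFixed hs top top-fixed) ,
                (λ i 1≤i _ i-fixed → fixed⇒≤top i 1≤i (isFixed⇒Fixes hs i i-fixed))
    ; ending = inj₂ (top<n , sym k≡ ,
                     trans (subst (λ k → hAt hs k ≡ 2 * n ∸ k + 1) (sym k≡) last≡) (2n∸[1+m]+1≡2n∸m n top<n))
    ; next = next }
    where
    top = length hs ∸ 1
    k≡ : suc top ≡ length hs
    k≡ = suc[k∸1]≡k (IsHeightSeq.nonempty shp)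
    top<n : top < n
    top<n = ≤-trans (≤-reflexive k≡) (IsHeightSeq.length≤n shp)
    fixed⇒≤top : ∀ c → 1 ≤ c → Fixes hs c → c ≤ top
    fixed⇒≤top c 1≤c c-fixed =
      ≤-pred (≤-trans (≤∧≢⇒< (fixed⇒≤length hs c 1≤c c-fixed) c≢k) (≤-reflexive (sym k≡)))
      where
      c≢k : c ≢ length hs
      c≢k refl = 2n∸k+1≢k n c 1≤n (trans (sym last≡) c-fixed)
    next : ∀ j → 1 ≤ j → j ≤ top → NextIn (isFixed hs) j (hAt hs j) top
    next j 1≤j j≤top with j ≤? top ∸ 1
    ... | yes j≤M = BlockCond⇒NextIn hs (length hs ∸ 2) top j block 1≤j
                      (≤-trans j≤M (≤-reflexive (∸-+-assoc (length hs) 1 1))) j≤top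
                      (λ c j<c _ c-fixed → fixed⇒≤top c (≤-trans 1≤j (<⇒≤ j<c)) c-fixed)
    ... | no  j≰M with j≤m∧j≰m∸1⇒j≡m 1≤j j≤top j≰M
    ...   | refl = Fixes⇒NextIn hs top top top-fixed ≤-refl

  Cond⇒Canonical : ∀ hs → IsHeightSeq n hs → Cond1 n hs ⊎ Cond2 n hs → Canonical (isFixed hs) hs
  Cond⇒Canonical hs shp = [ Cond1⇒Canonical hs shp , Cond2⇒Canonical hs shp ]′

  -- Regular elements

  -- x ≤ c always; conversely c is disjoint from x^c, since c fixes whatever x fixes.
  regular⇒canonical : ∀ x → IsRegular x → Canonical (isFixed (heights x)) (heights x)
  regular⇒canonical x (xᶜ , (x∧xᶜ≡0 , _) , (_ , xᶜᶜ-greatest)) = subst (Canonical S) (sym x≡c) c-canonical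
    where
    S = isFixed (heights x)
    c = proj₁ (canonical S)
    c-canonical = proj₂ (canonical S)
    x≤c : x ≤D c
    x≤c = Canonical-greatest S (heights c) c-canonical x (λ i _ _ Si → isFixed⇒Fixes (heights x) i Si)
    cover : FixCover xᶜ c
    cover i 1≤i i≤n with hAt (heights x) i ≟ i
    ... | yes x-fixes   = inj₂ (Canonical-fixes S (heights c) c-canonical i 1≤i i≤n (Fixes⇒isFixed (heights x) i x-fixes))
    ... | no  x-unfixed = inj₁ (Disjoint⇒fixes x xᶜ x∧xᶜ≡0 i 1≤i i≤n x-unfixed)
    c≤x : c ≤D x
    c≤x = xᶜᶜ-greatest c (FixCover⇒Disjoint xᶜ c cover)
    x≡c : heights x ≡ heights c
    x≡c = DomSeq-antisym _ _ x≤c c≤x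

  pseudocomplement : DB n → DB n
  pseudocomplement x = proj₁ (canonical (isUnfixed (heights x)))

  pseudocomplement-canonical : ∀ x → Canonical (isUnfixed (heights x)) (heights (pseudocomplement x))
  pseudocomplement-canonical x = proj₂ (canonical (isUnfixed (heights x)))

  cover-pseudocomplement : ∀ x → FixCover x (pseudocomplement x)
  cover-pseudocomplement x i 1≤i i≤n with hAt (heights x) i ≟ i
  ... | yes x-fixes   = inj₁ x-fixes
  ... | no  x-unfixed = inj₂ (Canonical-fixes _ _ (pseudocomplement-canonical x) i 1≤i i≤n
                                (¬Fixes⇒isUnfixed (heights x) i x-unfixed))

  pseudocomplement-IsPseudocomplement : ∀ x → IsPseudocomplement x (pseudocomplement x)
  pseudocomplement-IsPseudocomplement x = FixCover⇒Disjoint x (pseudocomplement x) (cover-pseudocomplement x) , greatest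
    where
    greatest : ∀ z → MeetIsBottom x z → z ≤D pseudocomplement x
    greatest z x∧z≡0 = Canonical-greatest _ _ (pseudocomplement-canonical x) z λ i 1≤i i≤n unfixedᵢ →
      Disjoint⇒fixes x z x∧z≡0 i 1≤i i≤n (isUnfixed⇒¬Fixes (heights x) i unfixedᵢ)

  canonical⇒regular : ∀ x → Canonical (isFixed (heights x)) (heights x) → IsRegular x
  canonical⇒regular x x-canonical =
    xᶜ , pseudocomplement-IsPseudocomplement x ,
    (FixCover⇒Disjoint xᶜ x (λ i 1≤i i≤n → swap (cover-pseudocomplement x i 1≤i i≤n)) , greatest)
    where
    xᶜ = pseudocomplement x
    greatest : ∀ z → MeetIsBottom xᶜ z → z ≤D x
    greatest z xᶜ∧z≡0 = Canonical-greatest _ _ x-canonical z λ i 1≤i i≤n fixedᵢ →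
      Disjoint⇒fixes xᶜ z xᶜ∧z≡0 i 1≤i i≤n λ xᶜ-fixes →
        isUnfixed⇒¬Fixes (heights x) i
          (Canonical-fixed⇒true _ _ (pseudocomplement-canonical x) i 1≤i i≤n xᶜ-fixes)
          (isFixed⇒Fixes (heights x) i fixedᵢ)

proposition3p14 : (n : ℕ) → 1 ≤ n → (p : DB n) →
    IsRegular p ⇔ (Cond1 n (heightSeq (word p)) ⊎ Cond2 n (heightSeq (word p)))
proposition3p14 n 1≤n p = mk⇔
  (λ regular → Canonical⇒Cond n 1≤n _ _ (regular⇒canonical n 1≤n p regular))
  (λ cond → canonical⇒regular n 1≤n p (Cond⇒Canonical n 1≤n _ (shape n 1≤n p) cond))
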